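{- Let $R_0=B_2B_3\cdots B_n$ with $B_c=(c-1)(c-2)\cdots 1$ (a reduced word of $w_0\in S_n$). For $1\le a<c\le n$, let $R_0^{(a,c)}$ be the word obtained from $R_0$ by deleting the letter $c-a$ in the block $B_c$, and let $v_{a,c}=\mathrm{Dem}(R_0^{(a,c)})$. Then, in one-line notation, \[v_{a,c}=n(n-1)\cdots(c+1)\,(c-1)(c-2)\cdots a\,c\,(a-1)\cdots1,\] equivalently $w_0=(a\ a+1\ \cdots\ c)\,v_{a,c}$ (composition $w_0(p)=\sigma(v_{a,c}(p))$ with $\sigma$ the cycle). Consequently $\mathrm{Supp}(v_{a,c})=[a,c]\cap\mathbb Z$, $\mathrm{Fwd}(v_{a,c})=\{a,a+1,\dots,c-1\}$, and $\mathrm{Bwd}(v_{a,c})=\{c\}$.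
   Context: $S_n$ has simple transpositions $s_i=(i\ i+1)$, length $\ell$, $w_0=n(n-1)\cdots1$. The Demazure product of a word $i_1\cdots i_L$ is $e*s_{i_1}*\cdots*s_{i_L}$ with $x*s_i=xs_i$ if $\ell(xs_i)>\ell(x)$ and $x*s_i=x$ otherwise. For $x\in S_n$, $\mathrm{pos}_x(t)=x^{ -1}(t)$, $\mathrm{Supp}(x)=\{t:\mathrm{pos}_x(t)\ne\mathrm{pos}_{w_0}(t)\}$, $\mathrm{Fwd}(x)=\{t:\mathrm{pos}_x(t)<\mathrm{pos}_{w_0}(t)\}$, $\mathrm{Bwd}(x)=\{t:\mathrm{pos}_x(t)>\mathrm{pos}_{w_0}(t)\}$. -}

module Defs where

open import Data.Nat using (ℕ; zero; suc; _+_; _∸_; _<_; _<?_; _≟_; _<ᵇ_; _≤ᵇ_; _≡ᵇ_)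
open import Data.Bool using (Bool; true; false; if_then_else_; _∧_)
open import Data.List using (List; []; _∷_; map; foldl; filter; length; upTo; concatMap; _++_)
open import Data.Nat.ListAction using (sum)
open import Relation.Nullary using (¬?)

-- Permutations of [n] = {1,...,n} are represented as functions ℕ → ℕ
-- (only the values on 1..n matter).
Perm : Set
Perm = ℕ → ℕ

range : ℕ → List ℕ
range n = map suc (upTo n)

oneLine : ℕ → Perm → List ℕ
oneLine n x = map x (range n)

e : Perm
e p = p

tr : ℕ → Perm
tr i p = if p ≡ᵇ i then suc i else (if p ≡ᵇ suc i then i else p)

mulS : Perm → ℕ → Perm
mulS x i p = x (tr i p)

-- Coxeter length = number of inversions (p < q, x p > x q) with 1 ≤ p < q ≤ n
len : ℕ → Perm → ℕ
len n x = sum (map (λ q → length (filter (λ p → x q <? x p) (range (q ∸ 1)))) (range n))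

demStep : ℕ → Perm → ℕ → Perm
demStep n x i = if len n x <ᵇ len n (mulS x i) then mulS x i else x

Dem : ℕ → List ℕ → Perm
Dem n w = foldl (demStep n) e w

w0 : ℕ → Perm
w0 n p = suc n ∸ p

B : ℕ → List ℕ
B c = map (λ k → c ∸ k) (range (c ∸ 1))

from2 : ℕ → List ℕ
from2 n = map suc (range (n ∸ 1))

R0 : ℕ → List ℕ
R0 n = concatMap B (from2 n)

R0del : ℕ → ℕ → ℕ → List ℕ
R0del n a c = concatMap
  (λ b → if b ≡ᵇ c then filter (λ l → ¬? (l ≟ (c ∸ a))) (B b) else B b)
  (from2 n)

-- decreasing list hi, hi-1, ..., lo  (empty if hi < lo)
desc : ℕ → ℕ → List ℕ
desc hi lo = map (λ k → suc hi ∸ k) (range (suc hi ∸ lo))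

cyc : ℕ → ℕ → Perm
cyc a c t = if (a ≤ᵇ t) ∧ (t <ᵇ c) then suc t else (if t ≡ᵇ c then a else t)

-- pos_x(t) = x^{-1}(t): the first position p in [1..n] with x p = t (0 if none)
posIn : Perm → ℕ → List ℕ → ℕ
posIn x t [] = 0
posIn x t (p ∷ ps) = if x p ≡ᵇ t then p else posIn x t ps

pos : ℕ → Perm → ℕ → ℕ
pos n x t = posIn x t (range n)

module Submission where

-- Swapping the entries at positions i, i+1 changes the number of inversions by exactly one, so the
-- Demazure step x * s_i multiplies by s_i at an ascent x(i) < x(i+1) and does nothing at a descent.
-- Hence the block B_{k+1} = k ⋯ 1, applied to a permutation that reverses [1,k] and fixes k+1, carries
-- the entry k+1 to the front: B_2 ⋯ B_{c-1} produces the longest element of S_{c-1}. In B_c with the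
-- letter c-a deleted, the letters c-1, …, c-a+1 carry c only as far as position c-a+1, and the letters
-- c-a-1, …, 1 meet descents only, so the result y satisfies cyc ∘ y = w0 on [1,c]. As cyc fixes
-- everything above c, the blocks B_{c+1}, …, B_n act on y as they would on a reversed prefix, whence
-- cyc ∘ v = w0 on [1,n]. Then pos_v(t) = w0(cyc t) and pos_{w0}(t) = w0(t), and the support and the
-- forward and backward sets are read off by comparing cyc t with t.

open import Defs
open import Data.Bool using (Bool; true; false; T; if_then_else_; _∧_)
open import Data.Bool.Properties using (T-≡)
open import Data.List using (List; []; _∷_; _++_; map; filter; length; foldl; concat; concatMap; upTo; applyUpTo)
open import Data.List.Properties
  using (map-++; map-∘; concatMap-++; filter-++; filter-all; filter-reject; length-++; foldl-++; upTo-∷ʳ; map-applyUpTo)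
open import Data.List.Relation.Unary.All using (All; []; _∷_)
open import Data.Nat
open import Data.Nat.ListAction using (sum)
open import Data.Nat.ListAction.Properties using (sum-++)
open import Data.Nat.Properties
open import Algebra.Properties.CommutativeSemigroup +-commutativeSemigroup using (xy∙z≈xz∙y)
open import Data.Nat.Tactic.RingSolver using (solve-∀)
open import Data.Product using (_×_; _,_; proj₁; proj₂)
open import Data.Sum using (_⊎_; inj₁; inj₂)
open import Function using (id; _∘_; _⇔_; mk⇔; Equivalence)
open import Function.Construct.Composition using (_⇔-∘_)
open import Relation.Binary.Definitions using (tri<; tri≈; tri>)
open import Relation.Binary.PropositionalEquality
open import Relation.Nullary using (¬_; ¬?; contradiction; yes; no)

T⇒≡true : ∀ {b} → T b → b ≡ true
T⇒≡true = Equivalence.to T-≡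

¬T⇒≡false : ∀ {b} → ¬ T b → b ≡ false
¬T⇒≡false {false} _ = refl
¬T⇒≡false {true} ¬t = contradiction _ ¬t

<ᵇ-true : ∀ {m n} → m < n → (m <ᵇ n) ≡ true
<ᵇ-true = T⇒≡true ∘ <⇒<ᵇ

<ᵇ-false : ∀ {m n} → n ≤ m → (m <ᵇ n) ≡ false
<ᵇ-false {m} {n} n≤m = ¬T⇒≡false (λ m<ᵇn → <⇒≱ (<ᵇ⇒< m n m<ᵇn) n≤m)

≤ᵇ-true : ∀ {m n} → m ≤ n → (m ≤ᵇ n) ≡ true
≤ᵇ-true = T⇒≡true ∘ ≤⇒≤ᵇ

≤ᵇ-false : ∀ {m n} → n < m → (m ≤ᵇ n) ≡ false
≤ᵇ-false {m} {n} n<m = ¬T⇒≡false (λ m≤ᵇn → <⇒≱ n<m (≤ᵇ⇒≤ m n m≤ᵇn))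

≡ᵇ-true : ∀ {m n} → m ≡ n → (m ≡ᵇ n) ≡ true
≡ᵇ-true {m} {n} = T⇒≡true ∘ ≡⇒≡ᵇ m n

≡ᵇ-false : ∀ {m n} → m ≢ n → (m ≡ᵇ n) ≡ false
≡ᵇ-false {m} {n} m≢n = ¬T⇒≡false (m≢n ∘ ≡ᵇ⇒≡ m n)

mulS-at-left : ∀ x i → mulS x i i ≡ x (suc i)
mulS-at-left x i rewrite ≡ᵇ-true (refl {x = i}) = refl

mulS-at-right : ∀ x i → mulS x i (suc i) ≡ x i
mulS-at-right x i rewrite ≡ᵇ-false (1+n≢n {i}) | ≡ᵇ-true (refl {x = suc i}) = refl

mulS-elsewhere : ∀ x i {p} → p ≢ i → p ≢ suc i → mulS x i p ≡ x p
mulS-elsewhere x i p≢i p≢1+i rewrite ≡ᵇ-false p≢i | ≡ᵇ-false p≢1+i = refl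

mulS-below : ∀ x i {p} → p < i → mulS x i p ≡ x p
mulS-below x i p<i = mulS-elsewhere x i (<⇒≢ p<i) (<⇒≢ (m<n⇒m<1+n p<i))

mulS-above : ∀ x i {p} → suc i < p → mulS x i p ≡ x p
mulS-above x i 1+i<p = mulS-elsewhere x i (>⇒≢ (<-trans (n<1+n i) 1+i<p)) (>⇒≢ 1+i<p)

infix 4 _≗[_]_

_≗[_]_ : Perm → ℕ → Perm → Set
y ≗[ k ] x = ∀ p → 1 ≤ p → p ≤ k → y p ≡ x p

≗-restrict : ∀ {x y k} → y ≗[ suc k ] x → y ≗[ k ] x
≗-restrict y≗x p 1≤p p≤k = y≗x p 1≤p (m≤n⇒m≤1+n p≤k)

mulS-agrees-below : ∀ x i → mulS x (suc i) ≗[ i ] x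
mulS-agrees-below x i p _ p≤i = mulS-below x (suc i) (s≤s p≤i)

iverson : Bool → ℕ
iverson true = 1
iverson false = 0

countAbove : ℕ → Perm → ℕ → ℕ
countAbove v x zero = 0
countAbove v x (suc k) = countAbove v x k + iverson (v <ᵇ x (suc k))

inversions : ℕ → Perm → ℕ
inversions zero x = 0
inversions (suc n) x = inversions n x + countAbove (x (suc n)) x n

range-∷ʳ : ∀ n → range (suc n) ≡ range n ++ suc n ∷ []
range-∷ʳ n = trans (cong (map suc) (sym (upTo-∷ʳ n))) (map-++ suc (upTo n) (n ∷ []))

length-filter≡countAbove : ∀ v x k → length (filter (λ p → v <? x p) (range k)) ≡ countAbove v x k
length-filter≡countAbove v x zero = refl
length-filter≡countAbove v x (suc k) = begin
  length (filter P? (range (suc k)))              ≡⟨ cong (length ∘ filter P?) (range-∷ʳ k) ⟩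
  length (filter P? (range k ++ suc k ∷ []))      ≡⟨ cong length (filter-++ P? (range k) _) ⟩
  length (filter P? (range k) ++ filter P? (suc k ∷ []))
    ≡⟨ length-++ (filter P? (range k)) ⟩
  length (filter P? (range k)) + length (filter P? (suc k ∷ []))
    ≡⟨ cong₂ _+_ (length-filter≡countAbove v x k) (singleton (suc k)) ⟩
  countAbove v x (suc k)                          ∎
  where
  open ≡-Reasoning
  P? = λ p → v <? x p
  singleton : ∀ q → length (filter P? (q ∷ [])) ≡ iverson (v <ᵇ x q)
  singleton q with v <ᵇ x q
  ... | true = refl
  ... | false = refl

len≡inversions : ∀ n x → len n x ≡ inversions n x
len≡inversions zero x = refl
len≡inversions (suc n) x = begin
  sum (map F (range (suc n)))                ≡⟨ cong (sum ∘ map F) (range-∷ʳ n) ⟩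
  sum (map F (range n ++ suc n ∷ []))        ≡⟨ cong sum (map-++ F (range n) _) ⟩
  sum (map F (range n) ++ F (suc n) ∷ [])    ≡⟨ sum-++ (map F (range n)) _ ⟩
  len n x + (F (suc n) + 0)
    ≡⟨ cong₂ _+_ (len≡inversions n x) (trans (+-identityʳ _) (length-filter≡countAbove _ x n)) ⟩
  inversions (suc n) x                       ∎
  where
  open ≡-Reasoning
  F : ℕ → ℕ
  F q = length (filter (λ p → x q <? x p) (range (q ∸ 1)))

countAbove-cong : ∀ v {x y} k → y ≗[ k ] x → countAbove v y k ≡ countAbove v x k
countAbove-cong v zero y≗x = refl
countAbove-cong v (suc k) y≗x = cong₂ (λ count w → count + iverson (v <ᵇ w))
  (countAbove-cong v k (≗-restrict y≗x)) (y≗x (suc k) (s≤s z≤n) ≤-refl)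

inversions-cong : ∀ {x y} k → y ≗[ k ] x → inversions k y ≡ inversions k x
inversions-cong zero y≗x = refl
inversions-cong {x} {y} (suc k) y≗x = cong₂ _+_ (inversions-cong k (≗-restrict y≗x)) (begin
  countAbove (y (suc k)) y k  ≡⟨ cong (λ v → countAbove v y k) (y≗x (suc k) (s≤s z≤n) ≤-refl) ⟩
  countAbove (x (suc k)) y k  ≡⟨ countAbove-cong _ k (≗-restrict y≗x) ⟩
  countAbove (x (suc k)) x k  ∎)
  where open ≡-Reasoning

countAbove-mulS : ∀ v x {i k} → 1 ≤ i → suc i ≤′ k → countAbove v (mulS x i) k ≡ countAbove v x k
countAbove-mulS v x {suc i} _ ≤′-refl
  rewrite mulS-at-left x (suc i) | mulS-at-right x (suc i) | countAbove-cong v i (mulS-agrees-below x i)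
  = xy∙z≈xz∙y (countAbove v x i) _ _
countAbove-mulS v x {i} 1≤i (≤′-step 1+i≤k) = cong₂ (λ count w → count + iverson (v <ᵇ w))
  (countAbove-mulS v x 1≤i 1+i≤k) (mulS-above x i (s≤s (≤′⇒≤ 1+i≤k)))

inversions-mulS : ∀ x {i k} → 1 ≤ i → suc i ≤′ k →
  inversions k (mulS x i) + iverson (x (suc i) <ᵇ x i) ≡ inversions k x + iverson (x i <ᵇ x (suc i))
inversions-mulS x {suc i} _ ≤′-refl
  rewrite mulS-at-left x (suc i) | mulS-at-right x (suc i)
        | inversions-cong i (mulS-agrees-below x i)
        | countAbove-cong (x (suc i)) i (mulS-agrees-below x i)
        | countAbove-cong (x (2+ i)) i (mulS-agrees-below x i)
  = rearrange (inversions i x) (countAbove (x (suc i)) x i) (countAbove (x (2+ i)) x i) _ _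
  where
  rearrange : ∀ I C₁ C₂ A B → I + C₂ + (C₁ + A) + B ≡ I + C₁ + (C₂ + B) + A
  rearrange = solve-∀
inversions-mulS x {i} 1≤i (≤′-step {k} 1+i≤k) = begin
  inversions k y + countAbove (y (suc k)) y k + down ≡⟨ cong (λ c → inversions k y + c + down) count-unchanged ⟩
  inversions k y + rest + down                       ≡⟨ xy∙z≈xz∙y _ rest down ⟩
  inversions k y + down + rest                       ≡⟨ cong (_+ rest) (inversions-mulS x 1≤i 1+i≤k) ⟩
  inversions k x + up + rest                         ≡⟨ xy∙z≈xz∙y _ up rest ⟩
  inversions k x + rest + up                         ∎
  where
  open ≡-Reasoning
  y = mulS x i
  up = iverson (x i <ᵇ x (suc i))
  down = iverson (x (suc i) <ᵇ x i)
  rest = countAbove (x (suc k)) x k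
  count-unchanged : countAbove (y (suc k)) y k ≡ rest
  count-unchanged = trans (cong (λ v → countAbove v y k) (mulS-above x i (s≤s (≤′⇒≤ 1+i≤k))))
                          (countAbove-mulS _ x 1≤i 1+i≤k)

len-mulS : ∀ {n} x {i} → 1 ≤ i → suc i ≤ n →
  len n (mulS x i) + iverson (x (suc i) <ᵇ x i) ≡ len n x + iverson (x i <ᵇ x (suc i))
len-mulS {n} x {i} 1≤i 1+i≤n rewrite len≡inversions n x | len≡inversions n (mulS x i) =
  inversions-mulS x 1≤i (≤⇒≤′ 1+i≤n)

len-mulS-ascent : ∀ {n} x {i} → 1 ≤ i → suc i ≤ n → x i < x (suc i) → len n x < len n (mulS x i)
len-mulS-ascent {n} x {i} 1≤i 1+i≤n ascent = begin-strict
  len n x                  <⟨ m<m+n _ z<s ⟩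
  len n x + 1              ≡⟨ subst₂ (λ b b′ → len n (mulS x i) + iverson b ≡ len n x + iverson b′)
                                     (<ᵇ-false (<⇒≤ ascent)) (<ᵇ-true ascent) (len-mulS x 1≤i 1+i≤n) ⟨
  len n (mulS x i) + 0     ≡⟨ +-identityʳ _ ⟩
  len n (mulS x i)         ∎
  where open ≤-Reasoning

len-mulS-descent : ∀ {n} x {i} → 1 ≤ i → suc i ≤ n → x (suc i) < x i → len n (mulS x i) < len n x
len-mulS-descent {n} x {i} 1≤i 1+i≤n descent = begin-strict
  len n (mulS x i)         <⟨ m<m+n _ z<s ⟩
  len n (mulS x i) + 1     ≡⟨ subst₂ (λ b b′ → len n (mulS x i) + iverson b ≡ len n x + iverson b′)
                                     (<ᵇ-true descent) (<ᵇ-false (<⇒≤ descent)) (len-mulS x 1≤i 1+i≤n) ⟩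
  len n x + 0              ≡⟨ +-identityʳ _ ⟩
  len n x                  ∎
  where open ≤-Reasoning

demStep-ascent : ∀ {n} x {i} → 1 ≤ i → suc i ≤ n → x i < x (suc i) → demStep n x i ≡ mulS x i
demStep-ascent x 1≤i 1+i≤n ascent rewrite <ᵇ-true (len-mulS-ascent x 1≤i 1+i≤n ascent) = refl

demStep-descent : ∀ {n} x {i} → 1 ≤ i → suc i ≤ n → x (suc i) < x i → demStep n x i ≡ x
demStep-descent x 1≤i 1+i≤n descent rewrite <ᵇ-false (<⇒≤ (len-mulS-descent x 1≤i 1+i≤n descent)) = refl

ascending : ℕ → ℕ → List ℕ
ascending b zero = []
ascending b (suc k) = b ∷ ascending (suc b) k

descending : ℕ → ℕ → List ℕ
descending lo zero = []
descending lo (suc k) = lo + k ∷ descending lo k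

applyUpTo-ascending : ∀ {f} b k → (∀ i → f i ≡ b + i) → applyUpTo f k ≡ ascending b k
applyUpTo-ascending b zero f≗ = refl
applyUpTo-ascending b (suc k) f≗ = cong₂ _∷_
  (trans (f≗ 0) (+-identityʳ b))
  (applyUpTo-ascending (suc b) k (λ i → trans (f≗ (suc i)) (+-suc b i)))

applyUpTo-descending : ∀ {f} lo k → (∀ i → f i ≡ lo + k ∸ suc i) → applyUpTo f k ≡ descending lo k
applyUpTo-descending lo zero f≗ = refl
applyUpTo-descending lo (suc k) f≗ = cong₂ _∷_
  (trans (f≗ 0) (cong (_∸ 1) (+-suc lo k)))
  (applyUpTo-descending lo k (λ i → trans (f≗ (suc i)) (cong (_∸ 2+ i) (+-suc lo k))))

map-range : ∀ (f : ℕ → ℕ) k → map f (range k) ≡ applyUpTo (f ∘ suc) k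
map-range f k = trans (cong (map f) (map-applyUpTo id suc k)) (map-applyUpTo suc f k)

range≡ascending : ∀ n → range n ≡ ascending 1 n
range≡ascending n = trans (map-applyUpTo id suc n) (applyUpTo-ascending 1 n (λ _ → refl))

from2≡ascending : ∀ n → from2 n ≡ ascending 2 (n ∸ 1)
from2≡ascending n = trans (map-range suc (n ∸ 1)) (applyUpTo-ascending 2 (n ∸ 1) (λ _ → refl))

B≡descending : ∀ k → B (suc k) ≡ descending 1 k
B≡descending k = trans (map-range (suc k ∸_) k) (applyUpTo-descending 1 k (λ _ → refl))

desc≡descending : ∀ {lo} hi → lo ≤ suc hi → desc hi lo ≡ descending lo (suc hi ∸ lo)
desc≡descending {lo} hi lo≤1+hi = trans (map-range (suc hi ∸_) (suc hi ∸ lo))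
  (applyUpTo-descending lo (suc hi ∸ lo) (λ i → cong (_∸ suc i) (sym (m+[n∸m]≡n lo≤1+hi))))

ascending-++ : ∀ b k d → ascending b (k + d) ≡ ascending b k ++ ascending (b + k) d
ascending-++ b zero d = cong (λ b′ → ascending b′ d) (sym (+-identityʳ b))
ascending-++ b (suc k) d = cong (b ∷_) (trans (ascending-++ (suc b) k d)
  (cong (λ b′ → ascending (suc b) k ++ ascending b′ d) (sym (+-suc b k))))

descending-++ : ∀ lo k m → descending lo (k + m) ≡ descending (lo + k) m ++ descending lo k
descending-++ lo k zero = cong (descending lo) (+-identityʳ k)
descending-++ lo k (suc m) rewrite +-suc k m = cong₂ _∷_ (sym (+-assoc lo k m)) (descending-++ lo k m)

map-descending : ∀ {f : ℕ → ℕ} lo lo′ k → (∀ i → i < k → f (lo + i) ≡ lo′ + i) →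
  map f (descending lo k) ≡ descending lo′ k
map-descending lo lo′ zero f-shifts = refl
map-descending lo lo′ (suc k) f-shifts =
  cong₂ _∷_ (f-shifts k ≤-refl) (map-descending lo lo′ k (λ i i<k → f-shifts i (m<n⇒m<1+n i<k)))

map-cong-ascending : ∀ {A : Set} {f g : ℕ → A} b k → (∀ p → b ≤ p → p < b + k → f p ≡ g p) →
  map f (ascending b k) ≡ map g (ascending b k)
map-cong-ascending b zero f≗g = refl
map-cong-ascending b (suc k) f≗g = cong₂ _∷_
  (f≗g b ≤-refl (m<m+n b z<s))
  (map-cong-ascending (suc b) k λ p b<p p<b+k → f≗g p (<⇒≤ b<p) (subst (p <_) (sym (+-suc b k)) p<b+k))

map-reflect-ascending : ∀ b k → map (b + k ∸_) (ascending b k) ≡ descending 1 k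
map-reflect-ascending b zero = refl
map-reflect-ascending b (suc k) = cong₂ _∷_
  (m+n∸m≡n b (suc k))
  (trans (cong (λ t → map (t ∸_) (ascending (suc b) k)) (+-suc b k)) (map-reflect-ascending (suc b) k))

All-descending : ∀ {P : ℕ → Set} lo k → (∀ i → i < k → P (lo + i)) → All P (descending lo k)
All-descending lo zero _ = []
All-descending lo (suc k) P-holds =
  P-holds k ≤-refl ∷ All-descending lo k (λ i i<k → P-holds i (m<n⇒m<1+n i<k))

posIn-ascending : ∀ x t {q} b k → b ≤ q → q < b + k → x q ≡ t → (∀ p → b ≤ p → p < q → x p ≢ t) →
  posIn x t (ascending b k) ≡ q
posIn-ascending x t b zero b≤q q<b+0 _ _ =
  contradiction (≤-trans q<b+0 (≤-reflexive (+-identityʳ b))) (≤⇒≯ b≤q)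
posIn-ascending x t {q} b (suc k) b≤q q<b+k x[q]≡t earlier with m≤n⇒m<n∨m≡n b≤q
... | inj₂ refl rewrite ≡ᵇ-true x[q]≡t = refl
... | inj₁ b<q rewrite ≡ᵇ-false (earlier b ≤-refl b<q) =
  posIn-ascending x t (suc b) k b<q (subst (q <_) (+-suc b k) q<b+k) x[q]≡t (λ p b<p → earlier p (<⇒≤ b<p))

infixl 5 _·[_]_

_·[_]_ : Perm → ℕ → List ℕ → Perm
x ·[ n ] w = foldl (demStep n) x w

record RotatedRight (lo hi : ℕ) (x y : Perm) : Set where
  field
    carried   : y (suc lo) ≡ x (suc hi)
    shifted   : ∀ p → lo < p → p ≤ hi → y (suc p) ≡ x p
    unchanged : ∀ p → p ≤ lo ⊎ suc hi < p → y p ≡ x p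

·-descending-rotates : ∀ {n} lo m x → suc (lo + m) ≤ n →
  (∀ p → lo < p → p ≤ lo + m → x p < x (suc (lo + m))) →
  RotatedRight lo (lo + m) x (x ·[ n ] descending (suc lo) m)
·-descending-rotates lo zero x _ _ = record
  { carried   = cong (x ∘ suc) (sym (+-identityʳ lo))
  ; shifted   = λ p lo<p p≤lo+0 → contradiction (≤-trans p≤lo+0 (≤-reflexive (+-identityʳ lo))) (<⇒≱ lo<p)
  ; unchanged = λ _ _ → refl
  }
·-descending-rotates {n} lo (suc m) x 2+i≤n below-last rewrite +-suc lo m
  | demStep-ascent x (s≤s z≤n) 2+i≤n (below-last (suc (lo + m)) (s≤s (m≤m+n lo m)) ≤-refl) = record
  { carried   = trans carried (mulS-at-left x i)
  ; shifted   = shifted′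
  ; unchanged = unchanged′
  }
  where
  i = suc (lo + m)
  x′ = mulS x i
  open RotatedRight (·-descending-rotates lo m x′ (<⇒≤ 2+i≤n) λ p lo<p p≤lo+m →
    subst₂ _<_ (sym (mulS-below x i (s≤s p≤lo+m))) (sym (mulS-at-left x i))
               (below-last p lo<p (m≤n⇒m≤1+n p≤lo+m)))
  shifted′ : ∀ p → lo < p → p ≤ i → (x′ ·[ n ] descending (suc lo) m) (suc p) ≡ x p
  shifted′ p lo<p p≤i with m≤n⇒m<n∨m≡n p≤i
  ... | inj₁ p<i = trans (shifted p lo<p (s≤s⁻¹ p<i)) (mulS-below x i p<i)
  ... | inj₂ refl = trans (unchanged (suc i) (inj₂ ≤-refl)) (mulS-at-right x i)
  unchanged′ : ∀ p → p ≤ lo ⊎ suc i < p → (x′ ·[ n ] descending (suc lo) m) p ≡ x p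
  unchanged′ p (inj₁ p≤lo) =
    trans (unchanged p (inj₁ p≤lo)) (mulS-below x i (s≤s (≤-trans p≤lo (m≤m+n lo m))))
  unchanged′ p (inj₂ 1+i<p) = trans (unchanged p (inj₂ (<-trans (n<1+n _) 1+i<p))) (mulS-above x i 1+i<p)

·-descending-fixes : ∀ {n} lo m x → suc (lo + m) ≤ n →
  (∀ p → lo < p → p ≤ lo + m → x (suc p) < x p) →
  x ·[ n ] descending (suc lo) m ≡ x
·-descending-fixes lo zero x _ _ = refl
·-descending-fixes lo (suc m) x 2+i≤n decreasing rewrite +-suc lo m
  | demStep-descent x (s≤s z≤n) 2+i≤n (decreasing (suc (lo + m)) (s≤s (m≤m+n lo m)) ≤-refl) =
  ·-descending-fixes lo m x (<⇒≤ 2+i≤n) (λ p lo<p p≤lo+m → decreasing p lo<p (m≤n⇒m≤1+n p≤lo+m))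

data Region (a c : ℕ) : ℕ → Set where
  below  : ∀ {t} → t < a → Region a c t
  inside : ∀ {t} → a ≤ t → t < c → Region a c t
  top    : Region a c c
  above  : ∀ {t} → c < t → Region a c t

region : ∀ a c t → Region a c t
region a c t with t <? a
... | yes t<a = below t<a
... | no t≮a with t <? c
...   | yes t<c = inside (≮⇒≥ t≮a) t<c
...   | no t≮c with t ≟ c
...     | yes refl = top
...     | no t≢c = above (≤∧≢⇒< (≮⇒≥ t≮c) (t≢c ∘ sym))

module _ {a c : ℕ} (a<c : a < c) where

  cyc-below : ∀ {t} → t < a → cyc a c t ≡ t
  cyc-below t<a rewrite ≤ᵇ-false t<a | ≡ᵇ-false (<⇒≢ (<-trans t<a a<c)) = refl

  cyc-inside : ∀ {t} → a ≤ t → t < c → cyc a c t ≡ suc t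
  cyc-inside a≤t t<c rewrite ≤ᵇ-true a≤t | <ᵇ-true t<c = refl

  cyc-top : cyc a c c ≡ a
  cyc-top rewrite ≤ᵇ-true (<⇒≤ a<c) | <ᵇ-false (≤-refl {c}) | ≡ᵇ-true (refl {x = c}) = refl

  cyc-above : ∀ {t} → c < t → cyc a c t ≡ t
  cyc-above c<t rewrite ≤ᵇ-true (<⇒≤ (<-trans a<c c<t)) | <ᵇ-false (<⇒≤ c<t) | ≡ᵇ-false (>⇒≢ c<t) = refl

  cycInv : ℕ → ℕ
  cycInv s = if s ≡ᵇ a then c else (if (a <ᵇ s) ∧ (s ≤ᵇ c) then pred s else s)

  cycInv-below : ∀ {s} → s < a → cycInv s ≡ s
  cycInv-below s<a rewrite ≡ᵇ-false (<⇒≢ s<a) | <ᵇ-false (<⇒≤ s<a) = refl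

  cycInv-a : cycInv a ≡ c
  cycInv-a rewrite ≡ᵇ-true (refl {x = a}) = refl

  cycInv-inside : ∀ {s} → a < s → s ≤ c → cycInv s ≡ pred s
  cycInv-inside a<s s≤c rewrite ≡ᵇ-false (>⇒≢ a<s) | <ᵇ-true a<s | ≤ᵇ-true s≤c = refl

  cycInv-above : ∀ {s} → c < s → cycInv s ≡ s
  cycInv-above c<s rewrite ≡ᵇ-false (>⇒≢ (<-trans a<c c<s)) | <ᵇ-true (<-trans a<c c<s) | ≤ᵇ-false c<s = refl

  cycInv-cyc : ∀ t → cycInv (cyc a c t) ≡ t
  cycInv-cyc t with region a c t
  ... | below t<a rewrite cyc-below t<a = cycInv-below t<a
  ... | inside a≤t t<c rewrite cyc-inside a≤t t<c = cycInv-inside (s≤s a≤t) t<c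
  ... | top rewrite cyc-top = cycInv-a
  ... | above c<t rewrite cyc-above c<t = cycInv-above c<t

  cyc-injective : ∀ {s t} → cyc a c s ≡ cyc a c t → s ≡ t
  cyc-injective {s} {t} eq = trans (sym (cycInv-cyc s)) (trans (cong cycInv eq) (cycInv-cyc t))

  cyc≢⇔ : ∀ {t} → (cyc a c t ≢ t) ⇔ (a ≤ t × t ≤ c)
  cyc≢⇔ {t} = mk⇔ (moved t (region a c t)) (fixed t (region a c t))
    where
    moved : ∀ t → Region a c t → cyc a c t ≢ t → a ≤ t × t ≤ c
    moved t (below t<a) moves = contradiction (cyc-below t<a) moves
    moved t (inside a≤t t<c) _ = a≤t , <⇒≤ t<c
    moved _ top _ = <⇒≤ a<c , ≤-refl
    moved t (above c<t) moves = contradiction (cyc-above c<t) moves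
    fixed : ∀ t → Region a c t → a ≤ t × t ≤ c → cyc a c t ≢ t
    fixed t (below t<a) (a≤t , _) = contradiction a≤t (<⇒≱ t<a)
    fixed t (inside a≤t t<c) _ eq = 1+n≢n (trans (sym (cyc-inside a≤t t<c)) eq)
    fixed _ top _ eq = <⇒≢ a<c (trans (sym cyc-top) eq)
    fixed t (above c<t) (_ , t≤c) = contradiction t≤c (<⇒≱ c<t)

  <cyc⇔ : ∀ {t} → (t < cyc a c t) ⇔ (a ≤ t × t < c)
  <cyc⇔ {t} = mk⇔ (raised t (region a c t)) λ (a≤t , t<c) → subst (t <_) (sym (cyc-inside a≤t t<c)) (n<1+n t)
    where
    raised : ∀ t → Region a c t → t < cyc a c t → a ≤ t × t < c
    raised t (below t<a) t<cyc = contradiction (subst (t <_) (cyc-below t<a) t<cyc) (n≮n t)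
    raised t (inside a≤t t<c) _ = a≤t , t<c
    raised _ top c<cyc = contradiction (subst (c <_) cyc-top c<cyc) (<-asym a<c)
    raised t (above c<t) t<cyc = contradiction (subst (t <_) (cyc-above c<t) t<cyc) (n≮n t)

  cyc<⇔ : ∀ {t} → (cyc a c t < t) ⇔ (t ≡ c)
  cyc<⇔ {t} = mk⇔ (lowered t (region a c t)) λ { refl → subst (_< c) (sym cyc-top) a<c }
    where
    lowered : ∀ t → Region a c t → cyc a c t < t → t ≡ c
    lowered t (below t<a) cyc<t = contradiction (subst (_< t) (cyc-below t<a) cyc<t) (n≮n t)
    lowered t (inside a≤t t<c) cyc<t = contradiction (subst (_< t) (cyc-inside a≤t t<c) cyc<t) (<-asym (n<1+n t))
    lowered _ top _ = refl
    lowered t (above c<t) cyc<t = contradiction (subst (_< t) (cyc-above c<t) cyc<t) (n≮n t)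

  cyc-bounds : ∀ {n t} → 1 ≤ a → c ≤ n → 1 ≤ t → t ≤ n → 1 ≤ cyc a c t × cyc a c t ≤ n
  cyc-bounds {t = t} 1≤a c≤n 1≤t t≤n with region a c t
  ... | below t<a rewrite cyc-below t<a = 1≤t , t≤n
  ... | inside a≤t t<c rewrite cyc-inside a≤t t<c = s≤s z≤n , ≤-trans t<c c≤n
  ... | top rewrite cyc-top = 1≤a , ≤-trans (<⇒≤ a<c) c≤n
  ... | above c<t rewrite cyc-above c<t = 1≤t , t≤n

w0-≢⇔ : ∀ {N s t} → s ≤ N → t ≤ N → (w0 N s ≢ w0 N t) ⇔ (s ≢ t)
w0-≢⇔ {N} s≤N t≤N = mk⇔ (λ w0s≢w0t s≡t → w0s≢w0t (cong (w0 N) s≡t))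
  (λ s≢t w0s≡w0t → s≢t (∸-cancelˡ-≡ (m≤n⇒m≤1+n s≤N) (m≤n⇒m≤1+n t≤N) w0s≡w0t))

w0-<⇔ : ∀ {N s t} → s ≤ N → (w0 N s < w0 N t) ⇔ (t < s)
w0-<⇔ s≤N = mk⇔ ∸-cancelʳ-< (λ t<s → ∸-monoʳ-< t<s (m≤n⇒m≤1+n s≤N))

w0-involutive : ∀ {N s} → s ≤ N → w0 N (w0 N s) ≡ s
w0-involutive s≤N = m∸[m∸n]≡n (m≤n⇒m≤1+n s≤N)

pos-reversed : ∀ {N φ x t} → φ ∘ x ≗[ N ] w0 N → (∀ {s u} → φ s ≡ φ u → s ≡ u) →
  1 ≤ φ t → φ t ≤ N → pos N x t ≡ w0 N (φ t)
pos-reversed {N} {φ} {x} {t} reverses φ-injective 1≤φt φt≤N =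
  trans (cong (posIn x t) (range≡ascending N)) (posIn-ascending x t 1 N 1≤q (s≤s q≤N) x[q]≡t earlier)
  where
  q = w0 N (φ t)
  1≤q : 1 ≤ q
  1≤q = ≤-trans (≤-reflexive (sym (m+n∸n≡m 1 N))) (∸-monoʳ-≤ (suc N) φt≤N)
  q≤N : q ≤ N
  q≤N = ∸-monoʳ-≤ (suc N) 1≤φt
  x[q]≡t : x q ≡ t
  x[q]≡t = φ-injective (trans (reverses q 1≤q q≤N) (w0-involutive φt≤N))
  earlier : ∀ p → 1 ≤ p → p < q → x p ≢ t
  earlier p 1≤p p<q x[p]≡t = <⇒≢ p<q (begin
    p                ≡⟨ w0-involutive p≤N ⟨
    w0 N (w0 N p)    ≡⟨ cong (w0 N) (reverses p 1≤p p≤N) ⟨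
    w0 N (φ (x p))   ≡⟨ cong (w0 N ∘ φ) x[p]≡t ⟩
    q                ∎)
    where
    open ≡-Reasoning
    p≤N = ≤-trans (<⇒≤ p<q) q≤N

-- The relabelling φ is id up to the block B_c and cyc a c from then on.
record Reversed (φ : ℕ → ℕ) (k : ℕ) (x : Perm) : Set where
  field
    reverses    : φ ∘ x ≗[ k ] w0 k
    fixes-above : ∀ p → k < p → x p ≡ p

·-B-reversed : ∀ {n φ k x} → suc k ≤ n → (∀ t → k < t → φ t ≡ t) → Reversed φ k x →
  Reversed φ (suc k) (x ·[ n ] B (suc k))
·-B-reversed {n} {φ} {k} {x} 1+k≤n φ-fixes x-reversed rewrite B≡descending k = record
  { reverses    = reverses′
  ; fixes-above = λ p 1+k<p → trans (unchanged p (inj₂ 1+k<p)) (fixes-above p (<-trans (n<1+n k) 1+k<p))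
  }
  where
  open Reversed x-reversed
  values-≤k : ∀ p → 1 ≤ p → p ≤ k → x p ≤ k
  values-≤k p 1≤p p≤k with x p ≤? k
  ... | yes x[p]≤k = x[p]≤k
  ... | no x[p]≰k = begin
    x p          ≡⟨ φ-fixes _ (≰⇒> x[p]≰k) ⟨
    φ (x p)      ≡⟨ reverses p 1≤p p≤k ⟩
    suc k ∸ p    ≤⟨ ∸-monoʳ-≤ (suc k) 1≤p ⟩
    k            ∎
    where open ≤-Reasoning
  open RotatedRight (·-descending-rotates 0 k x 1+k≤n λ p 1≤p p≤k →
    subst (x p <_) (sym (fixes-above (suc k) ≤-refl)) (s≤s (values-≤k p 1≤p p≤k)))
  reverses′ : φ ∘ (x ·[ n ] descending 1 k) ≗[ suc k ] w0 (suc k)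
  reverses′ (suc zero) _ _ =
    trans (cong φ (trans carried (fixes-above (suc k) ≤-refl))) (φ-fixes (suc k) ≤-refl)
  reverses′ (suc (suc q)) _ (s≤s q<k) =
    trans (cong φ (shifted (suc q) (s≤s z≤n) q<k)) (reverses (suc q) (s≤s z≤n) q<k)

·-blocks-reversed : ∀ {n φ} k d {x} → k + d ≤ n → (∀ t → k < t → φ t ≡ t) → Reversed φ k x →
  Reversed φ (k + d) (x ·[ n ] concatMap B (ascending (suc k) d))
·-blocks-reversed k zero _ _ x-reversed rewrite +-identityʳ k = x-reversed
·-blocks-reversed {n} k (suc d) {x} k+d≤n φ-fixes x-reversed rewrite +-suc k d
  | foldl-++ (demStep n) x (B (suc k)) (concatMap B (ascending (2+ k) d)) =
  ·-blocks-reversed (suc k) d k+d≤n (λ t 1+k<t → φ-fixes t (<-trans (n<1+n k) 1+k<t))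
    (·-B-reversed (≤-trans (s≤s (m≤m+n k d)) k+d≤n) φ-fixes x-reversed)

rotated-reversed : ∀ j m {x y} → Reversed id (suc (j + m)) x → RotatedRight (suc j) (suc (j + m)) x y →
  Reversed (cyc (suc m) (2+ (j + m))) (2+ (j + m)) y
rotated-reversed j m {x} {y} x-reversed rotated = record
  { reverses    = reverses′
  ; fixes-above = λ p c<p → trans (unchanged p (inj₂ c<p)) (fixes-above p (<-trans (n<1+n _) c<p))
  }
  where
  open Reversed x-reversed
  open RotatedRight rotated
  a = suc m
  c = 2+ (j + m)
  a<c : a < c
  a<c = s≤s (s≤s (m≤n+m m j))
  c∸[1+j]≡a : c ∸ suc j ≡ a
  c∸[1+j]≡a = trans (cong (_∸ j) (sym (+-suc j m))) (m+n∸m≡n j a)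
  reverses′ : cyc a c ∘ y ≗[ c ] w0 c
  reverses′ p 1≤p p≤c with <-cmp p (2+ j)
  ... | tri< p<2+j _ _ = begin
    cyc a c (y p)     ≡⟨ cong (cyc a c) (trans (unchanged p (inj₁ p≤1+j)) (reverses p 1≤p p≤1+j+m)) ⟩
    cyc a c (c ∸ p)   ≡⟨ cyc-inside a<c a≤c∸p (∸-monoʳ-< 1≤p p≤c) ⟩
    suc (c ∸ p)       ≡⟨ +-∸-assoc 1 p≤c ⟨
    suc c ∸ p         ∎
    where
    open ≡-Reasoning
    p≤1+j = s≤s⁻¹ p<2+j
    p≤1+j+m = ≤-trans p≤1+j (s≤s (m≤m+n j m))
    a≤c∸p = subst (_≤ c ∸ p) c∸[1+j]≡a (∸-monoʳ-≤ c p≤1+j)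
  ... | tri≈ _ refl _ = begin
    cyc a c (y (2+ j))  ≡⟨ cong (cyc a c) (trans carried (fixes-above c ≤-refl)) ⟩
    cyc a c c           ≡⟨ cyc-top a<c ⟩
    a                   ≡⟨ c∸[1+j]≡a ⟨
    c ∸ suc j           ∎
    where open ≡-Reasoning
  reverses′ (suc q) _ 1+q≤c | tri> _ _ 2+j<1+q = begin
    cyc a c (y (suc q)) ≡⟨ cong (cyc a c) (trans (shifted q 1+j<q q≤1+j+m) (reverses q 1≤q q≤1+j+m)) ⟩
    cyc a c (c ∸ q)     ≡⟨ cyc-below a<c c∸q<a ⟩
    c ∸ q               ∎
    where
    open ≡-Reasoning
    1+j<q = s≤s⁻¹ 2+j<1+q
    1≤q = ≤-trans (s≤s z≤n) 1+j<q
    q≤1+j+m = s≤s⁻¹ 1+q≤c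
    c∸q<a = s≤s (subst (c ∸ q ≤_) (m+n∸m≡n j m) (∸-monoʳ-≤ c 1+j<q))

·-deleted-block-reversed : ∀ {n} j m {x} → 2+ (j + m) ≤ n → Reversed id (suc (j + m)) x →
  Reversed (cyc (suc m) (2+ (j + m))) (2+ (j + m)) (x ·[ n ] (descending (2+ j) m ++ descending 1 j))
·-deleted-block-reversed {n} j m {x} c≤n x-reversed =
  subst (Reversed _ _) (sym tail-fixes) (rotated-reversed j m x-reversed rotated)
  where
  open Reversed x-reversed
  y = x ·[ n ] descending (2+ j) m
  rotated : RotatedRight (suc j) (suc (j + m)) x y
  rotated = ·-descending-rotates (suc j) m x c≤n λ p 1+j<p p≤1+j+m →
    subst₂ _<_ (sym (reverses p (≤-trans (s≤s z≤n) 1+j<p) p≤1+j+m)) (sym (fixes-above _ ≤-refl))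
               (∸-monoʳ-< (≤-trans (s≤s z≤n) 1+j<p) (m≤n⇒m≤1+n p≤1+j+m))
  open RotatedRight rotated
  head-values : ∀ p → 1 ≤ p → p ≤ suc j → y p ≡ 2+ (j + m) ∸ p
  head-values p 1≤p p≤1+j =
    trans (unchanged p (inj₁ p≤1+j)) (reverses p 1≤p (≤-trans p≤1+j (s≤s (m≤m+n j m))))
  head-decreasing : ∀ p → 0 < p → p ≤ j → y (suc p) < y p
  head-decreasing p 1≤p p≤j =
    subst₂ _<_ (sym (head-values (suc p) (s≤s z≤n) (s≤s p≤j))) (sym (head-values p 1≤p (m≤n⇒m≤1+n p≤j)))
               (∸-monoʳ-< (n<1+n p) (s≤s (m≤n⇒m≤1+n (≤-trans p≤j (m≤m+n j m)))))
  tail-fixes : x ·[ n ] (descending (2+ j) m ++ descending 1 j) ≡ y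
  tail-fixes = trans (foldl-++ (demStep n) x (descending (2+ j) m) (descending 1 j))
    (·-descending-fixes 0 j y (≤-trans (s≤s (≤-trans (m≤m+n j m) (n≤1+n _))) c≤n) head-decreasing)

-- 1 ≤ a < c ≤ n written as a = 1 + m, c - a = 1 + j (the deleted letter) and n - c = d.
data Gaps : ℕ → ℕ → ℕ → Set where
  gaps : ∀ m j d → Gaps (2+ (j + m) + d) (suc m) (2+ (j + m))

gaps-of : ∀ {n a c} → 1 ≤ a → a < c → c ≤ n → Gaps n a c
gaps-of {a = suc m} _ a<c c≤n with m≤n⇒∃[o]m+o≡n a<c
... | j , refl with m≤n⇒∃[o]m+o≡n c≤n
... | d , refl rewrite +-comm m j = gaps m j d

deleteLetter : ℕ → List ℕ → List ℕ
deleteLetter l = filter (λ l′ → ¬? (l′ ≟ l))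

deleteLetter-B : ∀ j m → deleteLetter (suc j) (B (2+ (j + m))) ≡ descending (2+ j) m ++ descending 1 j
deleteLetter-B j m = begin
  deleteLetter (suc j) (B (2+ (j + m)))
    ≡⟨ cong (deleteLetter (suc j)) (trans (B≡descending (suc (j + m))) (descending-++ 1 (suc j) m)) ⟩
  deleteLetter (suc j) (descending (2+ j) m ++ suc j ∷ descending 1 j)
    ≡⟨ filter-++ P? (descending (2+ j) m) _ ⟩
  deleteLetter (suc j) (descending (2+ j) m) ++ deleteLetter (suc j) (suc j ∷ descending 1 j)
    ≡⟨ cong₂ _++_ (filter-all P? (All-descending (2+ j) m λ i _ → >⇒≢ (s≤s (s≤s (m≤m+n j i)))))
                  (trans (filter-reject P? (λ ≢ → ≢ refl))
                         (filter-all P? (All-descending 1 j λ _ i<j → <⇒≢ (s≤s i<j)))) ⟩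
  descending (2+ j) m ++ descending 1 j
    ∎
  where
  open ≡-Reasoning
  P? = λ l′ → ¬? (l′ ≟ suc j)

-- Definitionally the block function of R0del: R0del n a c unfolds to concatMap (R0del-block a c) (from2 n).
R0del-block : ℕ → ℕ → ℕ → List ℕ
R0del-block a c b = if b ≡ᵇ c then deleteLetter (c ∸ a) (B b) else B b

concatMap-R0del-block-away : ∀ a c b k → (∀ p → b ≤ p → p < b + k → p ≢ c) →
  concatMap (R0del-block a c) (ascending b k) ≡ concatMap B (ascending b k)
concatMap-R0del-block-away a c b k away = cong concat (map-cong-ascending b k λ p b≤p p<b+k →
  cong (if_then deleteLetter (c ∸ a) (B p) else B p) (≡ᵇ-false (away p b≤p p<b+k)))

R0del-split : ∀ m j d → let c = 2+ (j + m) in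
  R0del (c + d) (suc m) c ≡
    concatMap B (ascending 2 (j + m)) ++ (descending (2+ j) m ++ descending 1 j) ++ concatMap B (ascending (suc c) d)
R0del-split m j d = begin
  concatMap (R0del-block a c) (from2 (c + d))
    ≡⟨ cong (concatMap (R0del-block a c)) letters-split ⟩
  concatMap (R0del-block a c) (ascending 2 (j + m) ++ ascending c (suc d))
    ≡⟨ concatMap-++ (R0del-block a c) (ascending 2 (j + m)) _ ⟩
  concatMap (R0del-block a c) (ascending 2 (j + m)) ++ R0del-block a c c
    ++ concatMap (R0del-block a c) (ascending (suc c) d)
    ≡⟨ cong₂ _++_ (concatMap-R0del-block-away a c 2 (j + m) λ p _ p<c → <⇒≢ p<c)
                  (cong₂ _++_ deleted-block (concatMap-R0del-block-away a c (suc c) d λ p c<p _ → >⇒≢ c<p)) ⟩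
  concatMap B (ascending 2 (j + m)) ++ (descending (2+ j) m ++ descending 1 j) ++ concatMap B (ascending (suc c) d)
    ∎
  where
  open ≡-Reasoning
  a = suc m
  c = 2+ (j + m)
  letters-split : from2 (c + d) ≡ ascending 2 (j + m) ++ ascending c (suc d)
  letters-split = trans (from2≡ascending (c + d))
    (trans (cong (ascending 2) (sym (+-suc (j + m) d))) (ascending-++ 2 (j + m) (suc d)))
  deleted-block : R0del-block a c c ≡ descending (2+ j) m ++ descending 1 j
  deleted-block rewrite ≡ᵇ-true (refl {x = c}) | m+n∸n≡m (suc j) m = deleteLetter-B j m

Dem-R0del-reversed : ∀ {n a c} → 1 ≤ a → a < c → c ≤ n → Reversed (cyc a c) n (Dem n (R0del n a c))
Dem-R0del-reversed 1≤a a<c c≤n with gaps-of 1≤a a<c c≤n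
... | gaps m j d = subst (Reversed (cyc a c) (c + d)) (sym word-splits)
  (·-blocks-reversed c d ≤-refl (λ _ → cyc-above a<c)
    (·-deleted-block-reversed j m (m≤m+n c d)
      -- B 1 is empty, so starting from k = 0 runs through exactly the blocks B_2 ⋯ B_{c-1} of the prefix.
      (·-blocks-reversed 0 (suc (j + m)) (≤-trans (n≤1+n _) (m≤m+n c d)) (λ _ _ → refl) identity-reversed)))
  where
  a = suc m
  c = 2+ (j + m)
  prefix = concatMap B (ascending 2 (j + m))
  middle = descending (2+ j) m ++ descending 1 j
  suffix = concatMap B (ascending (suc c) d)
  word-splits : Dem (c + d) (R0del (c + d) a c) ≡ e ·[ c + d ] prefix ·[ c + d ] middle ·[ c + d ] suffix
  word-splits = trans (cong (e ·[ c + d ]_) (R0del-split m j d))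
    (trans (foldl-++ (demStep (c + d)) e prefix (middle ++ suffix)) (foldl-++ (demStep (c + d)) _ middle suffix))
  identity-reversed : Reversed id 0 e
  identity-reversed = record { reverses = λ { (suc _) _ () } ; fixes-above = λ _ _ → refl }

oneLine-reversed : ∀ {n a c v} → 1 ≤ a → a < c → c ≤ n → cyc a c ∘ v ≗[ n ] w0 n →
  oneLine n v ≡ desc n (suc c) ++ desc (c ∸ 1) a ++ (c ∷ []) ++ desc (a ∸ 1) 1
oneLine-reversed {v = v} 1≤a a<c c≤n reverses with gaps-of 1≤a a<c c≤n
... | gaps m j d = begin
  map v (range n)                               ≡⟨ cong (map v) (range≡ascending n) ⟩
  map v (ascending 1 n)                         ≡⟨ map-cong-ascending 1 n (λ p 1≤p → v-values p 1≤p ∘ s≤s⁻¹) ⟩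
  map (cycInv′ ∘ w0 n) (ascending 1 n)          ≡⟨ map-∘ (ascending 1 n) ⟩
  map cycInv′ (map (w0 n) (ascending 1 n))      ≡⟨ cong (map cycInv′) (map-reflect-ascending 1 n) ⟩
  map cycInv′ (descending 1 n)                  ≡⟨ cong (map cycInv′) descending-split ⟩
  map cycInv′ (upper ++ middle ++ a ∷ lower)    ≡⟨ map-++ cycInv′ upper _ ⟩
  map cycInv′ upper ++ map cycInv′ (middle ++ a ∷ lower)
    ≡⟨ cong (map cycInv′ upper ++_) (map-++ cycInv′ middle _) ⟩
  map cycInv′ upper ++ map cycInv′ middle ++ cycInv′ a ∷ map cycInv′ lower
    ≡⟨ cong₂ _++_ upper-fixed (cong₂ _++_ middle-lowered (cong₂ _∷_ (cycInv-a a<c) lower-fixed)) ⟩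
  upper ++ descending a (suc j) ++ c ∷ lower
    ≡⟨ cong₂ (λ u w → u ++ w ++ c ∷ lower) desc-upper desc-middle ⟨
  desc n (suc c) ++ desc (c ∸ 1) a ++ c ∷ lower
    ≡⟨ cong (λ w → desc n (suc c) ++ desc (c ∸ 1) a ++ c ∷ w) (desc≡descending m (s≤s z≤n)) ⟨
  desc n (suc c) ++ desc (c ∸ 1) a ++ (c ∷ []) ++ desc (a ∸ 1) 1
    ∎
  where
  open ≡-Reasoning
  a = suc m
  c = 2+ (j + m)
  n = c + d
  upper = descending (suc c) d
  middle = descending (suc a) (suc j)
  lower = descending 1 m
  cycInv′ = cycInv a<c
  v-values : ∀ p → 1 ≤ p → p ≤ n → v p ≡ cycInv′ (w0 n p)
  v-values p 1≤p p≤n = trans (sym (cycInv-cyc a<c (v p))) (cong cycInv′ (reverses p 1≤p p≤n))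
  descending-split : descending 1 n ≡ upper ++ middle ++ a ∷ lower
  descending-split = trans (descending-++ 1 c d) (cong (upper ++_)
    (trans (cong (descending 1) (cong suc (trans (cong suc (+-comm j m)) (sym (+-suc m j)))))
           (descending-++ 1 a (suc j))))
  upper-fixed : map cycInv′ upper ≡ upper
  upper-fixed = map-descending (suc c) (suc c) d λ i _ → cycInv-above a<c (s≤s (m≤m+n c i))
  middle-lowered : map cycInv′ middle ≡ descending a (suc j)
  middle-lowered = map-descending (suc a) a (suc j) λ i i<1+j → cycInv-inside a<c (s≤s (s≤s (m≤m+n m i)))
    (s≤s (s≤s (≤-trans (+-monoʳ-≤ m (s≤s⁻¹ i<1+j)) (≤-reflexive (+-comm m j)))))
  lower-fixed : map cycInv′ lower ≡ lower
  lower-fixed = map-descending 1 1 m λ i i<m → cycInv-below a<c (s≤s i<m)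
  desc-upper : desc n (suc c) ≡ upper
  desc-upper = trans (desc≡descending n (s≤s c≤n)) (cong (descending (suc c)) (m+n∸m≡n c d))
  desc-middle : desc (c ∸ 1) a ≡ descending a (suc j)
  desc-middle = trans (desc≡descending (suc (j + m)) (s≤s (≤-trans (m≤n+m m j) (n≤1+n _))))
    (cong (descending a) (m+n∸n≡m (suc j) m))

lemma3p27 : (n a c : ℕ) → 1 ≤ a → a < c → c ≤ n →
    (oneLine n (Dem n (R0del n a c)) ≡ desc n (suc c) ++ desc (c ∸ 1) a ++ (c ∷ []) ++ desc (a ∸ 1) 1)
    × ((p : ℕ) → 1 ≤ p → p ≤ n → w0 n p ≡ cyc a c (Dem n (R0del n a c) p))
    × ((t : ℕ) → 1 ≤ t → t ≤ n →
        ((pos n (Dem n (R0del n a c)) t ≢ pos n (w0 n) t → (a ≤ t × t ≤ c))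
          × ((a ≤ t × t ≤ c) → pos n (Dem n (R0del n a c)) t ≢ pos n (w0 n) t)))
    × ((t : ℕ) → 1 ≤ t → t ≤ n →
        ((pos n (Dem n (R0del n a c)) t < pos n (w0 n) t → (a ≤ t × t < c))
          × ((a ≤ t × t < c) → pos n (Dem n (R0del n a c)) t < pos n (w0 n) t)))
    × ((t : ℕ) → 1 ≤ t → t ≤ n →
        ((pos n (Dem n (R0del n a c)) t > pos n (w0 n) t → t ≡ c)
          × (t ≡ c → pos n (Dem n (R0del n a c)) t > pos n (w0 n) t)))
lemma3p27 n a c 1≤a a<c c≤n =
  oneLine-reversed 1≤a a<c c≤n reverses ,
  (λ p 1≤p p≤n → sym (reverses p 1≤p p≤n)) ,
  (λ t 1≤t t≤n → both-ways (support⇔ t 1≤t t≤n)) ,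
  (λ t 1≤t t≤n → both-ways (forward⇔ t 1≤t t≤n)) ,
  (λ t 1≤t t≤n → both-ways (backward⇔ t 1≤t t≤n))
  where
  v = Dem n (R0del n a c)
  open Reversed (Dem-R0del-reversed 1≤a a<c c≤n)
  both-ways : ∀ {A B : Set} → A ⇔ B → (A → B) × (B → A)
  both-ways A⇔B = Equivalence.to A⇔B , Equivalence.from A⇔B
  cyc-t≤n : ∀ {t} → 1 ≤ t → t ≤ n → cyc a c t ≤ n
  cyc-t≤n 1≤t t≤n = proj₂ (cyc-bounds a<c 1≤a c≤n 1≤t t≤n)
  pos-v : ∀ t → 1 ≤ t → t ≤ n → pos n v t ≡ w0 n (cyc a c t)
  pos-v t 1≤t t≤n =
    pos-reversed reverses (cyc-injective a<c) (proj₁ (cyc-bounds a<c 1≤a c≤n 1≤t t≤n)) (cyc-t≤n 1≤t t≤n)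
  pos-w0 : ∀ t → 1 ≤ t → t ≤ n → pos n (w0 n) t ≡ w0 n t
  pos-w0 t = pos-reversed (λ _ _ _ → refl) id
  support⇔ : ∀ t → 1 ≤ t → t ≤ n → (pos n v t ≢ pos n (w0 n) t) ⇔ (a ≤ t × t ≤ c)
  support⇔ t 1≤t t≤n rewrite pos-v t 1≤t t≤n | pos-w0 t 1≤t t≤n =
    cyc≢⇔ a<c ⇔-∘ w0-≢⇔ (cyc-t≤n 1≤t t≤n) t≤n
  forward⇔ : ∀ t → 1 ≤ t → t ≤ n → (pos n v t < pos n (w0 n) t) ⇔ (a ≤ t × t < c)
  forward⇔ t 1≤t t≤n rewrite pos-v t 1≤t t≤n | pos-w0 t 1≤t t≤n =
    <cyc⇔ a<c ⇔-∘ w0-<⇔ (cyc-t≤n 1≤t t≤n)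
  backward⇔ : ∀ t → 1 ≤ t → t ≤ n → (pos n (w0 n) t < pos n v t) ⇔ (t ≡ c)
  backward⇔ t 1≤t t≤n rewrite pos-v t 1≤t t≤n | pos-w0 t 1≤t t≤n =
    cyc<⇔ a<c ⇔-∘ w0-<⇔ t≤n
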